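{- Let $(G,\oplus,0)$ and $(G,\boxplus,0')$ be abelian groups on the same ground set $G$, and suppose that for some integer $d\geqslant 2$ and some $c,c'\in G$, \[ x_1\oplus\dotsb\oplus x_{d+1} =c \iff x_1\boxplus\dotsb\boxplus x_{d+1}=c'\quad\text{for all }x_1,\dots,x_{d+1}\in G.\] Then the map $(G,\oplus,0) \to (G,\boxplus,0')$, $x\mapsto x\boxminus 0 = x \oplus 0'$, is a group isomorphism, and \[ c'=c\boxplus \underbrace{0 \boxplus \dotsb \boxplus 0}_\text{$d$ times} = c \ominus (\underbrace{0' \oplus \dotsb \oplus 0'}_\text{$d$ times}). \]
   Context: $\boxminus$ and $\ominus$ denote subtraction in the groups $(G,\boxplus)$ and $(G,\oplus)$ respectively. -}

module Defs where

open import Level using (Level)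
open import Data.Nat using (ℕ; zero; suc)
open import Data.Fin using (Fin; zero; suc)
open import Relation.Binary.PropositionalEquality using (_≡_)
open import Algebra.Bundles.Raw using (RawGroup)

-- Iterated (non-empty) operation: op-sum op k x = x 0 `op` (x 1 `op` (... `op` x k)),
-- i.e. the operation applied to the k+1 elements x 0 , ... , x k.
op-sum : ∀ {a} {G : Set a} → (G → G → G) → (k : ℕ) → (Fin (suc k) → G) → G
op-sum op zero    x = x zero
op-sum op (suc k) x = op (x zero) (op-sum op k (λ i → x (suc i)))

rawGroup≡ : ∀ {a} (G : Set a) → (G → G → G) → G → (G → G) → RawGroup a a
rawGroup≡ G op e inv = record { Carrier = G ; _≈_ = _≡_ ; _∙_ = op ; ε = e ; _⁻¹ = inv }

module Submission where

-- Completing a pair (a , b) by the tail (⊖ (a ⊕ b) ⊕ c , 𝟘 , … , 𝟘) gives a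
-- (d+1)-tuple of ⊕-sum c; the tail depends on a and b only through a ⊕ b,
-- so pairs with equal ⊕-sum have equal ⊞-sum after cancelling the common
-- tail (this needs d ≥ 2: two free slots plus one for the tail).  Comparing
-- (a , b) with (a ⊕ b , 𝟘) gives  a ⊕ b = (a ⊞ b) ⊞ ⊟ 𝟘.  A general fact about
-- abelian groups then says that whenever one law is the other translated by
-- u, the translation x ↦ x ⊞ u is a group isomorphism.  Finally, the
-- formulas for c' come from the tuples (c , 𝟘 , … , 𝟘) and (c' , 𝟘' , … , 𝟘').

open import Defs
open import Data.Nat using (ℕ; zero; suc; _≤_; _∸_; z≤n; s≤s)
open import Data.Fin using (Fin)
open import Data.Product using (_×_; _,_)
open import Data.Vec.Functional using (_∷_)
open import Function.Base using (const)
open import Function.Bundles using (_⇔_; Equivalence)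
open import Relation.Binary.PropositionalEquality
  using (_≡_; refl; sym; trans; cong; module ≡-Reasoning)
open import Algebra.Core using (Op₁; Op₂)
open import Algebra.Bundles using (Group; AbelianGroup)
open import Algebra.Structures using (IsMonoid; IsGroup; IsAbelianGroup)
open import Algebra.Morphism.Structures using (module GroupMorphisms)
import Algebra.Properties.Group as GroupProperties
import Algebra.Properties.CommutativeSemigroup as CommutativeSemigroupProperties

group≡ : ∀ {a} {G : Set a} {_∙_ : Op₂ G} {ε : G} {_⁻¹ : Op₁ G} →
         IsGroup _≡_ _∙_ ε _⁻¹ → Group a a
group≡ isGroup = record { isGroup = isGroup }

abelianGroup≡ : ∀ {a} {G : Set a} {_∙_ : Op₂ G} {ε : G} {_⁻¹ : Op₁ G} →
                IsAbelianGroup _≡_ _∙_ ε _⁻¹ → AbelianGroup a a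
abelianGroup≡ isAbelianGroup = record { isAbelianGroup = isAbelianGroup }

module IteratedSums {a} {G : Set a} {_∙_ : Op₂ G} {ε : G}
                    (M : IsMonoid _≡_ _∙_ ε) where
  open IsMonoid M using (identityˡ; identityʳ)

  sum-ε : ∀ k → op-sum _∙_ k (const ε) ≡ ε
  sum-ε zero    = refl
  sum-ε (suc k) = trans (cong (ε ∙_) (sum-ε k)) (identityˡ ε)

  sum-single : ∀ k x → op-sum _∙_ k (x ∷ const ε) ≡ x
  sum-single zero    x = refl
  sum-single (suc k) x = trans (cong (x ∙_) (sum-ε k)) (identityʳ x)

module MagmaHomomorphismOfGroups
    {a b} {G : Set a} {H : Set b}
    {_∙_ : Op₂ G} {ε : G} {_⁻¹ : Op₁ G}
    {_◦_ : Op₂ H} {e : H} {inv : Op₁ H}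
    (A : IsGroup _≡_ _∙_ ε _⁻¹) (B : IsGroup _≡_ _◦_ e inv)
    (f : G → H) (homo : ∀ x y → f (x ∙ y) ≡ f x ◦ f y) where
  open IsGroup A using (identityˡ; inverseˡ)
  open GroupProperties (group≡ B) using (identityˡ-unique; inverseˡ-unique)

  preserves-identity : f ε ≡ e
  preserves-identity =
    identityˡ-unique (f ε) (f ε) (trans (sym (homo ε ε)) (cong f (identityˡ ε)))

  preserves-inverse : ∀ x → f (x ⁻¹) ≡ inv (f x)
  preserves-inverse x = inverseˡ-unique (f (x ⁻¹)) (f x)
    (trans (sym (homo (x ⁻¹) x)) (trans (cong f (inverseˡ x)) preserves-identity))

translation-isomorphism :
  ∀ {a} {G : Set a}
    {_⊕_ : Op₂ G} {𝟘 : G} {⊖_ : Op₁ G}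
    {_⊞_ : Op₂ G} {𝟘' : G} {⊟_ : Op₁ G} →
    IsGroup _≡_ _⊕_ 𝟘 ⊖_ → IsAbelianGroup _≡_ _⊞_ 𝟘' ⊟_ →
    (u : G) → (∀ x y → x ⊕ y ≡ (x ⊞ y) ⊞ u) →
    GroupMorphisms.IsGroupIsomorphism
      (rawGroup≡ G _⊕_ 𝟘 ⊖_) (rawGroup≡ G _⊞_ 𝟘' ⊟_) (λ x → x ⊞ u)
translation-isomorphism {G = G} {_⊕_} {𝟘} {⊖_} {_⊞_} {𝟘'} {⊟_} A B u ⊕-is-translate =
  record
    { isGroupMonomorphism = record
      { isGroupHomomorphism = record
        { isMonoidHomomorphism = record
          { isMagmaHomomorphism = record
            { isRelHomomorphism = record { cong = cong τ }
            ; homo = homo }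
          ; ε-homo = preserves-identity }
        ; ⁻¹-homo = preserves-inverse }
      ; injective = λ {x} {y} → ∙-cancelʳ u x y }
    ; surjective = λ y → y ⊞ (⊟ u) , λ { refl → //-rightDividesˡ u y } }
  where
  open AbelianGroup (abelianGroup≡ B) using (assoc; isGroup; commutativeSemigroup)
  open GroupProperties (group≡ isGroup) using (∙-cancelʳ; //-rightDividesˡ)
  open CommutativeSemigroupProperties commutativeSemigroup using (interchange)
  open ≡-Reasoning

  τ : G → G
  τ x = x ⊞ u

  homo : ∀ x y → τ (x ⊕ y) ≡ τ x ⊞ τ y
  homo x y = begin
    (x ⊕ y) ⊞ u          ≡⟨ cong (_⊞ u) (⊕-is-translate x y) ⟩
    ((x ⊞ y) ⊞ u) ⊞ u    ≡⟨ assoc (x ⊞ y) u u ⟩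
    (x ⊞ y) ⊞ (u ⊞ u)    ≡⟨ interchange x y u u ⟩
    (x ⊞ u) ⊞ (y ⊞ u)    ∎

  open MagmaHomomorphismOfGroups A isGroup τ homo
    using (preserves-identity; preserves-inverse)

module SumCondition
    {a} {G : Set a}
    {_⊕_ : Op₂ G} {𝟘 : G} {⊖_ : Op₁ G}
    {_⊞_ : Op₂ G} {𝟘' : G} {⊟_ : Op₁ G}
    (A : IsAbelianGroup _≡_ _⊕_ 𝟘 ⊖_) (B : IsAbelianGroup _≡_ _⊞_ 𝟘' ⊟_)
    (k : ℕ) (c c' : G)
    (condition : ∀ x → (op-sum _⊕_ (suc (suc k)) x ≡ c) ⇔ (op-sum _⊞_ (suc (suc k)) x ≡ c'))
    where
  private
    d = suc (suc k)
    module A = IsAbelianGroup A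
    module B = IsAbelianGroup B
    module PA = GroupProperties (group≡ A.isGroup)
    module PB = GroupProperties (group≡ B.isGroup)

  ⊕-to-⊞ : ∀ x → op-sum _⊕_ d x ≡ c → op-sum _⊞_ d x ≡ c'
  ⊕-to-⊞ x = Equivalence.to (condition x)

  ⊞-to-⊕ : ∀ x → op-sum _⊞_ d x ≡ c' → op-sum _⊕_ d x ≡ c
  ⊞-to-⊕ x = Equivalence.from (condition x)

  completion : G → Fin (suc k) → G
  completion s = ((⊖ s) ⊕ c) ∷ const 𝟘

  completes : ∀ a b → op-sum _⊕_ d (a ∷ b ∷ completion (a ⊕ b)) ≡ c
  completes a b = begin
    a ⊕ (b ⊕ op-sum _⊕_ k (completion (a ⊕ b)))
      ≡⟨ cong (λ t → a ⊕ (b ⊕ t)) (IteratedSums.sum-single A.isMonoid k ((⊖ (a ⊕ b)) ⊕ c)) ⟩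
    a ⊕ (b ⊕ ((⊖ (a ⊕ b)) ⊕ c))
      ≡⟨ sym (A.assoc a b _) ⟩
    (a ⊕ b) ⊕ ((⊖ (a ⊕ b)) ⊕ c)
      ≡⟨ PA.\\-leftDividesˡ (a ⊕ b) c ⟩
    c ∎
    where open ≡-Reasoning

  pair-transfer : ∀ a b a' b' → a ⊕ b ≡ a' ⊕ b' → a ⊞ b ≡ a' ⊞ b'
  pair-transfer a b a' b' same-sum = PB.∙-cancelʳ rest (a ⊞ b) (a' ⊞ b') (begin
    (a ⊞ b) ⊞ rest      ≡⟨ B.assoc a b rest ⟩
    a ⊞ (b ⊞ rest)      ≡⟨ ⊕-to-⊞ (a ∷ b ∷ tail) (completes a b) ⟩
    c'                  ≡⟨ ⊕-to-⊞ (a' ∷ b' ∷ tail) completes' ⟨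
    a' ⊞ (b' ⊞ rest)    ≡⟨ B.assoc a' b' rest ⟨
    (a' ⊞ b') ⊞ rest    ∎)
    where
    open ≡-Reasoning
    tail = completion (a ⊕ b)
    rest = op-sum _⊞_ k tail
    completes' : op-sum _⊕_ d (a' ∷ b' ∷ tail) ≡ c
    completes' = trans (cong (λ s → op-sum _⊕_ d (a' ∷ b' ∷ completion s)) same-sum)
                       (completes a' b')

  -- ⊕ is ⊞ translated by ⊟ 𝟘: compare the pairs (a , b) and (a ⊕ b , 𝟘).
  ⊕-is-translate : ∀ a b → a ⊕ b ≡ (a ⊞ b) ⊞ (⊟ 𝟘)
  ⊕-is-translate a b = PB.x≈z//y (a ⊕ b) 𝟘 (a ⊞ b)
    (sym (pair-transfer a b (a ⊕ b) 𝟘 (sym (A.identityʳ (a ⊕ b)))))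

  translation-formula : ∀ x → x ⊞ (⊟ 𝟘) ≡ x ⊕ 𝟘'
  translation-formula x =
    sym (trans (⊕-is-translate x 𝟘') (cong (_⊞ (⊟ 𝟘)) (B.identityʳ x)))

  c'-from-c : c' ≡ c ⊞ op-sum _⊞_ (suc k) (const 𝟘)
  c'-from-c = sym (⊕-to-⊞ (c ∷ const 𝟘) (IteratedSums.sum-single A.isMonoid d c))

  c'-from-c-dual : c' ≡ c ⊕ (⊖ op-sum _⊕_ (suc k) (const 𝟘'))
  c'-from-c-dual = PA.x≈z//y c' _ c
    (⊞-to-⊕ (c' ∷ const 𝟘') (IteratedSums.sum-single B.isMonoid d c'))

proposition3p12 : ∀ {a} (G : Set a)
    (_⊕_ : G → G → G) (𝟘 : G) (⊖_ : G → G)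
    (_⊞_ : G → G → G) (𝟘' : G) (⊟_ : G → G) →
    IsAbelianGroup _≡_ _⊕_ 𝟘 ⊖_ →
    IsAbelianGroup _≡_ _⊞_ 𝟘' ⊟_ →
    (d : ℕ) → 2 ≤ d → (c c' : G) →
    ((x : _) → (op-sum _⊕_ d x ≡ c) ⇔ (op-sum _⊞_ d x ≡ c')) →
    ((x : G) → x ⊞ (⊟ 𝟘) ≡ x ⊕ 𝟘')
    × GroupMorphisms.IsGroupIsomorphism
    (rawGroup≡ G _⊕_ 𝟘 ⊖_) (rawGroup≡ G _⊞_ 𝟘' ⊟_) (λ x → x ⊞ (⊟ 𝟘))
    × (c' ≡ c ⊞ op-sum _⊞_ (d ∸ 1) (λ _ → 𝟘))
    × (c' ≡ c ⊕ (⊖ op-sum _⊕_ (d ∸ 1) (λ _ → 𝟘')))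
proposition3p12 G _⊕_ 𝟘 ⊖_ _⊞_ 𝟘' ⊟_ A B (suc (suc k)) (s≤s (s≤s z≤n)) c c' condition =
  translation-formula ,
  translation-isomorphism (IsAbelianGroup.isGroup A) B (⊟ 𝟘) ⊕-is-translate ,
  c'-from-c ,
  c'-from-c-dual
  where open SumCondition A B k c c' condition
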